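{- If $G$ and $H$ are non-trivial connected graphs and $\gamma_{r2}(H)\ge 4$, then \[\gamma_{r2}(G\circ H)=2\gamma_t(G).\]
   Context: All graphs are finite and simple; non-trivial means at least two vertices. A $2$-rainbow dominating function of a graph $X$ is a map $f\colon V(X)\to 2^{\{1,2\}}$ such that for every vertex $v$ with $f(v)=\emptyset$ we have $\bigcup_{u\in N(v)} f(u)=\{1,2\}$; its weight is $\sum_v |f(v)|$, and $\gamma_{r2}(X)$ is the minimum weight of such a function. The lexicographic product $G\circ H$ has vertex set $V(G)\times V(H)$, with $(g_1,h_1)$ adjacent to $(g_2,h_2)$ iff $g_1g_2\in E(G)$, or $g_1=g_2$ and $h_1h_2\in E(H)$. $\gamma_t(G)$ is the total domination number of $G$: the minimum size of a set $S\subseteq V(G)$ such that every vertex of $G$ has a neighbor in $S$. -}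

module Defs where

open import Data.Nat using (ℕ; zero; suc; _+_; _*_; _≤_)
open import Data.Fin using (Fin; zero; suc; remQuot)
open import Data.Bool using (Bool; true; false; _∧_; _∨_; if_then_else_)
open import Data.Product using (_×_; _,_; proj₁; proj₂; Σ; ∃; ∃-syntax)
open import Relation.Binary.PropositionalEquality using (_≡_; _≢_)
open import Data.Fin using (_≟_)
open import Relation.Nullary.Decidable using (⌊_⌋)

record Graph : Set where
  constructor mkGraph
  field
    n     : ℕ
    adj   : Fin n → Fin n → Bool
open Graph public

Simple : Graph → Set
Simple G = (∀ u v → adj G u v ≡ adj G v u) × (∀ v → adj G v v ≡ false)

Vertex : Graph → Set
Vertex G = Fin (n G)

Adj : (G : Graph) → Vertex G → Vertex G → Set
Adj G u v = adj G u v ≡ true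

sumFin : ∀ {k} → (Fin k → ℕ) → ℕ
sumFin {zero}  f = 0
sumFin {suc k} f = f zero + sumFin (λ i → f (suc i))

b2n : Bool → ℕ
b2n true  = 1
b2n false = 0

NonTrivial : Graph → Set
NonTrivial G = 2 ≤ n G

data Walk (G : Graph) : Vertex G → Vertex G → Set where
  here : ∀ {v} → Walk G v v
  step : ∀ {u v w} → Adj G u v → Walk G v w → Walk G u w

Connected : Graph → Set
Connected G = ∀ u v → Walk G u v

-- lexicographic product G ∘ H on Fin (n G * n H), vertex index
-- combine g h ↔ (g , h)  (via remQuot)
lexAdj : (G H : Graph) → Fin (n G * n H) → Fin (n G * n H) → Bool
lexAdj G H x y with remQuot {n G} (n H) x | remQuot {n G} (n H) y
... | (g₁ , h₁) | (g₂ , h₂) = adj G g₁ g₂ ∨ (⌊ g₁ ≟ g₂ ⌋ ∧ adj H h₁ h₂)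

_∘L_ : Graph → Graph → Graph
G ∘L H = mkGraph (n G * n H) (lexAdj G H)

IsTDS : (G : Graph) → (Vertex G → Bool) → Set
IsTDS G S = ∀ v → ∃[ u ] (Adj G v u × S u ≡ true)

size : (G : Graph) → (Vertex G → Bool) → ℕ
size G S = sumFin (λ v → b2n (S v))

IsγT : Graph → ℕ → Set
IsγT G k = (∃[ S ] (IsTDS G S × size G S ≡ k))
         × (∀ S → IsTDS G S → k ≤ size G S)

-- 2-rainbow function: f v = (1 ∈ f(v) , 2 ∈ f(v))
R2Fun : Graph → Set
R2Fun G = Vertex G → Bool × Bool

IsR2DF : (G : Graph) → R2Fun G → Set
IsR2DF G f = ∀ v → f v ≡ (false , false) →
  (∃[ u ] (Adj G v u × proj₁ (f u) ≡ true)) ×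
  (∃[ u ] (Adj G v u × proj₂ (f u) ≡ true))

weight : (G : Graph) → R2Fun G → ℕ
weight G f = sumFin (λ v → b2n (proj₁ (f v)) + b2n (proj₂ (f v)))

Isγr2 : Graph → ℕ → Set
Isγr2 G k = (∃[ f ] (IsR2DF G f × weight G f ≡ k))
          × (∀ f → IsR2DF G f → k ≤ weight G f)

-- Upper bound: labelling (s , h₀) with {1,2} for every s in a minimum total dominating set S
-- of G gives a 2-rainbow dominating function of weight 2|S|.
-- Lower bound: let f be a 2-rainbow dominating function of G ∘ H and, for a colour c, let D_c
-- be the set of g whose fibre {g} × H carries c. If g has no neighbour in D_c, every empty
-- vertex of the fibre at g gets c from inside the fibre, so giving both colours to its
-- c-vertices yields a 2-rainbow dominating function of H; as γr2(H) ≥ 4 the fibre has weight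
-- at least 2 plus what it carries of the other colour. Adding a neighbour of each such g to D_c
-- gives a total dominating set of G, and summing the fibre estimates bounds the sizes of the
-- two sets (c = 1, 2) together by the weight of f.
-- Non-triviality is used only to pick a vertex h₀ of H.
module Submission where

open import Defs
open import Data.Nat using (ℕ; zero; suc; _+_; _*_; _≤_; z≤n; s≤s)
open import Data.Nat.Properties
  using (+-0-commutativeMonoid; +-assoc; +-identityʳ; +-mono-≤; +-monoˡ-≤; +-monoʳ-≤;
         ≤-refl; ≤-reflexive; ≤-trans; <⇒≤; n≤1+n; module ≤-Reasoning)
open import Data.Fin using (Fin; zero; suc; combine; remQuot; _↑ˡ_; _↑ʳ_; fromℕ<; _≟_)
open import Data.Fin.Properties using (remQuot-combine; combine-remQuot)
open import Data.Bool using (Bool; true; false; _∧_; _∨_; not; if_then_else_)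
open import Data.Bool.Properties using (∨-zeroʳ; ∨-identityʳ)
open import Data.Product using (_×_; _,_; proj₁; proj₂; ∃-syntax)
open import Data.Sum using (_⊎_; inj₁; inj₂; map₂)
open import Relation.Nullary using (Dec; yes; no; contradiction)
open import Relation.Nullary.Decidable using (⌊_⌋; isYes≗does; dec-true; ⌊⌋-map′)
open import Relation.Binary.PropositionalEquality
open import Algebra.Properties.CommutativeMonoid.Sum +-0-commutativeMonoid
  using (sum; ∑-distrib-+; ∑-comm; sum-cong-≗; sum-replicate-zero)

sumFin≡sum : ∀ {k} (f : Fin k → ℕ) → sumFin f ≡ sum f
sumFin≡sum {zero}  f = refl
sumFin≡sum {suc k} f = cong (f zero +_) (sumFin≡sum (λ i → f (suc i)))

sumFin-cong : ∀ {k} {f g : Fin k → ℕ} → (∀ i → f i ≡ g i) → sumFin f ≡ sumFin g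
sumFin-cong {f = f} {g} f≗g =
  trans (sumFin≡sum f) (trans (sum-cong-≗ f≗g) (sym (sumFin≡sum g)))

sumFin-zero : ∀ k → sumFin {k} (λ _ → 0) ≡ 0
sumFin-zero k = trans (sumFin≡sum {k} (λ _ → 0)) (sum-replicate-zero k)

sumFin-distrib-+ : ∀ {k} (f g : Fin k → ℕ) →
  sumFin (λ i → f i + g i) ≡ sumFin f + sumFin g
sumFin-distrib-+ f g = begin
  sumFin (λ i → f i + g i) ≡⟨ sumFin≡sum (λ i → f i + g i) ⟩
  sum (λ i → f i + g i)    ≡⟨ ∑-distrib-+ f g ⟩
  sum f + sum g            ≡⟨ cong₂ _+_ (sumFin≡sum f) (sumFin≡sum g) ⟨
  sumFin f + sumFin g      ∎
  where open ≡-Reasoning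

sumFin-comm : ∀ {a b} (f : Fin a → Fin b → ℕ) →
  sumFin (λ i → sumFin (f i)) ≡ sumFin (λ j → sumFin (λ i → f i j))
sumFin-comm f = begin
  sumFin (λ i → sumFin (f i))          ≡⟨ sumFin-cong (λ i → sumFin≡sum (f i)) ⟩
  sumFin (λ i → sum (f i))             ≡⟨ sumFin≡sum (λ i → sum (f i)) ⟩
  sum (λ i → sum (f i))                ≡⟨ ∑-comm f ⟩
  sum (λ j → sum (λ i → f i j))        ≡⟨ sumFin≡sum (λ j → sum (λ i → f i j)) ⟨
  sumFin (λ j → sum (λ i → f i j))     ≡⟨ sumFin-cong (λ j → sumFin≡sum (λ i → f i j)) ⟨
  sumFin (λ j → sumFin (λ i → f i j))  ∎
  where open ≡-Reasoning

sumFin-mono : ∀ {k} {f g : Fin k → ℕ} → (∀ i → f i ≤ g i) → sumFin f ≤ sumFin g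
sumFin-mono {zero}  f≤g = z≤n
sumFin-mono {suc k} f≤g = +-mono-≤ (f≤g zero) (sumFin-mono (λ i → f≤g (suc i)))

sumFin-↑ : ∀ m {n} (f : Fin (m + n) → ℕ) →
  sumFin f ≡ sumFin (λ i → f (i ↑ˡ n)) + sumFin (λ j → f (m ↑ʳ j))
sumFin-↑ zero    f = refl
sumFin-↑ (suc m) f =
  trans (cong (f zero +_) (sumFin-↑ m (λ i → f (suc i)))) (sym (+-assoc (f zero) _ _))

sumFin-combine : ∀ m {n} (f : Fin (m * n) → ℕ) →
  sumFin f ≡ sumFin (λ i → sumFin (λ j → f (combine {m} {n} i j)))
sumFin-combine zero    f = refl
sumFin-combine (suc m) {n} f =
  trans (sumFin-↑ n f)
        (cong (sumFin (λ j → f (j ↑ˡ m * n)) +_) (sumFin-combine m (λ x → f (n ↑ʳ x))))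

card : ∀ {k} → (Fin k → Bool) → ℕ
card S = sumFin (λ v → b2n (S v))

any : ∀ {k} → (Fin k → Bool) → Bool
any {zero}  p = false
any {suc k} p = p zero ∨ any (λ i → p (suc i))

any-intro : ∀ {k} (p : Fin k → Bool) i → p i ≡ true → any p ≡ true
any-intro p zero    pi = cong (_∨ any (λ j → p (suc j))) pi
any-intro p (suc i) pi = trans (cong (p zero ∨_) (any-intro (λ j → p (suc j)) i pi)) (∨-zeroʳ (p zero))

any-elim : ∀ {k} (p : Fin k → Bool) → any p ≡ true → ∃[ i ] (p i ≡ true)
any-elim {suc k} p any-p with p zero in p0
... | true  = zero , p0
... | false with any-elim (λ i → p (suc i)) any-p
...   | i , pi = suc i , pi

b2n-any≤card : ∀ {k} (p : Fin k → Bool) → b2n (any p) ≤ card p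
b2n-any≤card {zero}  p = z≤n
b2n-any≤card {suc k} p with p zero
... | true  = s≤s z≤n
... | false = b2n-any≤card (λ i → p (suc i))

∧-true : ∀ x {y} → x ∧ y ≡ true → x ≡ true × y ≡ true
∧-true true y≡true = refl , y≡true

∨-true : ∀ x {y} → x ∨ y ≡ true → x ≡ true ⊎ y ≡ true
∨-true true  _      = inj₁ refl
∨-true false y≡true = inj₂ y≡true

_∪_ : ∀ {k} → (Fin k → Bool) → (Fin k → Bool) → Fin k → Bool
(A ∪ B) v = A v ∨ B v

b2n-∨ : ∀ x y → b2n (x ∨ y) ≤ b2n x + b2n y
b2n-∨ false y     = ≤-refl
b2n-∨ true  false = ≤-refl
b2n-∨ true  true  = n≤1+n 1

card-∪ : ∀ {k} (A B : Fin k → Bool) → card (A ∪ B) ≤ card A + card B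
card-∪ A B = ≤-trans (sumFin-mono (λ v → b2n-∨ (A v) (B v)))
                     (≤-reflexive (sumFin-distrib-+ (λ v → b2n (A v)) (λ v → b2n (B v))))

card-singleton : ∀ {k} (u : Fin k) → card (λ v → ⌊ u ≟ v ⌋) ≡ 1
card-singleton {suc k} zero    = cong suc (sumFin-zero k)
card-singleton {suc k} (suc u) =
  trans (sumFin-cong (λ v → cong b2n (⌊⌋-map′ _ _ (u ≟ v)))) (card-singleton u)

card-∧-singleton : ∀ {k} b (u : Fin k) → card (λ v → b ∧ ⌊ u ≟ v ⌋) ≡ b2n b
card-∧-singleton {k} false u = sumFin-zero k
card-∧-singleton true  u = card-singleton u

isYes-≟-refl : ∀ {k} (u : Fin k) → ⌊ u ≟ u ⌋ ≡ true
isYes-≟-refl u = trans (isYes≗does (u ≟ u)) (dec-true (u ≟ u) refl)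

image : ∀ {a b} → (Fin a → Fin b) → (Fin a → Bool) → Fin b → Bool
image φ U v = any (λ u → U u ∧ ⌊ φ u ≟ v ⌋)

image-intro : ∀ {a b} (φ : Fin a → Fin b) U u → U u ≡ true → image φ U (φ u) ≡ true
image-intro φ U u Uu =
  any-intro (λ u′ → U u′ ∧ ⌊ φ u′ ≟ φ u ⌋) u (cong₂ _∧_ Uu (isYes-≟-refl (φ u)))

card-image : ∀ {a b} (φ : Fin a → Fin b) U → card (image φ U) ≤ card U
card-image {a} {b} φ U = begin
  card (image φ U)                           ≤⟨ sumFin-mono (λ v → b2n-any≤card (δ v)) ⟩
  sumFin (λ v → sumFin (λ u → b2n (δ v u)))  ≡⟨ sumFin-comm (λ v u → b2n (δ v u)) ⟩
  sumFin (λ u → card (λ v → δ v u))          ≡⟨ sumFin-cong (λ u → card-∧-singleton (U u) (φ u)) ⟩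
  card U                                     ∎
  where
  open ≤-Reasoning
  δ : Fin b → Fin a → Bool
  δ v u = U u ∧ ⌊ φ u ≟ v ⌋

dominated : (G : Graph) → (Vertex G → Bool) → Vertex G → Bool
dominated G D v = any (λ u → adj G v u ∧ D u)

undominated : (G : Graph) → (Vertex G → Bool) → Vertex G → Bool
undominated G D v = not (dominated G D v)

tdsCompletion : (G : Graph) → (Vertex G → Vertex G) → (Vertex G → Bool) → Vertex G → Bool
tdsCompletion G nb D = D ∪ image nb (undominated G D)

tdsCompletion-IsTDS : (G : Graph) (nb : Vertex G → Vertex G) → (∀ v → Adj G v (nb v)) →
  (D : Vertex G → Bool) → IsTDS G (tdsCompletion G nb D)
tdsCompletion-IsTDS G nb v~nb D v with dominated G D v in v-dom
... | true  = let u , v~u∧Du = any-elim (λ u → adj G v u ∧ D u) v-dom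
                  v~u , Du = ∧-true (adj G v u) v~u∧Du
              in u , v~u , cong (_∨ image nb (undominated G D) u) Du
... | false = nb v , v~nb v ,
  trans (cong (D (nb v) ∨_) (image-intro nb (undominated G D) v (cong not v-dom)))
        (∨-zeroʳ (D (nb v)))

card-tdsCompletion : (G : Graph) (nb : Vertex G → Vertex G) (D : Vertex G → Bool) →
  card (tdsCompletion G nb D) ≤ sumFin (λ v → b2n (D v) + b2n (undominated G D v))
card-tdsCompletion G nb D = begin
  card (tdsCompletion G nb D)      ≤⟨ card-∪ D (image nb U) ⟩
  card D + card (image nb U)       ≤⟨ +-monoʳ-≤ (card D) (card-image nb U) ⟩
  card D + card U                  ≡⟨ sumFin-distrib-+ (λ v → b2n (D v)) (λ v → b2n (U v)) ⟨
  sumFin (λ v → b2n (D v) + b2n (U v)) ∎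
  where
  open ≤-Reasoning
  U = undominated G D

data Colour : Set where
  one two : Colour

other : Colour → Colour
other one = two
other two = one

has : Colour → Bool × Bool → Bool
has one = proj₁
has two = proj₂

∅ : Bool × Bool
∅ = false , false

labelSize : Bool × Bool → ℕ
labelSize p = b2n (proj₁ p) + b2n (proj₂ p)

IsR2DF-neighbour : (X : Graph) (f : R2Fun X) → IsR2DF X f →
  ∀ c v → f v ≡ ∅ → ∃[ u ] (Adj X v u × has c (f u) ≡ true)
IsR2DF-neighbour X f f-r2df one v fv≡∅ = proj₁ (f-r2df v fv≡∅)
IsR2DF-neighbour X f f-r2df two v fv≡∅ = proj₂ (f-r2df v fv≡∅)

saturate : Colour → Bool × Bool → Bool × Bool
saturate c p = if has c p then (true , true) else p

saturate-has : ∀ c p → has c p ≡ true → saturate c p ≡ (true , true)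
saturate-has c p cp rewrite cp = refl

saturate-∅ : ∀ c p → saturate c p ≡ ∅ → p ≡ ∅
saturate-∅ c p sat≡∅ with has c p
... | false = sat≡∅

labelSize-saturate : ∀ c p → labelSize (saturate c p) + b2n (has (other c) p) ≤ labelSize p + labelSize p
labelSize-saturate one (true  , true)  = n≤1+n 3
labelSize-saturate one (true  , false) = ≤-refl
labelSize-saturate one (false , b)     = ≤-refl
labelSize-saturate two (true  , true)  = n≤1+n 3
labelSize-saturate two (false , true)  = ≤-refl
labelSize-saturate two (true  , false) = ≤-refl
labelSize-saturate two (false , false) = ≤-refl

saturate-IsR2DF : (X : Graph) (f : R2Fun X) (c : Colour) →
  (∀ v → f v ≡ ∅ → ∃[ u ] (Adj X v u × has c (f u) ≡ true)) →
  IsR2DF X (λ v → saturate c (f v))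
saturate-IsR2DF X f c c-dom v sat≡∅ =
  let u , v~u , cu = c-dom v (saturate-∅ c (f v) sat≡∅)
  in (u , v~u , cong proj₁ (saturate-has c (f u) cu)) , (u , v~u , cong proj₂ (saturate-has c (f u) cu))

weight-saturate : (X : Graph) (f : R2Fun X) (c : Colour) →
  weight X (λ v → saturate c (f v)) + b2n (any (λ v → has (other c) (f v))) ≤ weight X f + weight X f
weight-saturate X f c = begin
  weight X (λ v → saturate c (f v)) + b2n (any (λ v → has (other c) (f v)))
    ≤⟨ +-monoʳ-≤ (weight X (λ v → saturate c (f v))) (b2n-any≤card (λ v → has (other c) (f v))) ⟩
  weight X (λ v → saturate c (f v)) + card (λ v → has (other c) (f v))
    ≡⟨ sumFin-distrib-+ (λ v → labelSize (saturate c (f v))) (λ v → b2n (has (other c) (f v))) ⟨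
  sumFin (λ v → labelSize (saturate c (f v)) + b2n (has (other c) (f v)))
    ≤⟨ sumFin-mono (λ v → labelSize-saturate c (f v)) ⟩
  sumFin (λ v → labelSize (f v) + labelSize (f v))
    ≡⟨ sumFin-distrib-+ (λ v → labelSize (f v)) (λ v → labelSize (f v)) ⟩
  weight X f + weight X f ∎
  where open ≤-Reasoning

b2n-any-has≤weight : (X : Graph) (f : R2Fun X) →
  b2n (any (λ v → has one (f v))) + b2n (any (λ v → has two (f v))) ≤ weight X f
b2n-any-has≤weight X f = ≤-trans
  (+-mono-≤ (b2n-any≤card (λ v → has one (f v))) (b2n-any≤card (λ v → has two (f v))))
  (≤-reflexive (sym (sumFin-distrib-+ (λ v → b2n (has one (f v))) (λ v → b2n (has two (f v))))))

combine-elim : ∀ {m n} (P : Fin (m * n) → Set) → (∀ i j → P (combine i j)) → ∀ x → P x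
combine-elim {m} {n} P P-combine x =
  subst P (combine-remQuot {m} n x) (P-combine (proj₁ (remQuot {m} n x)) (proj₂ (remQuot {m} n x)))

weight-∘L : (G H : Graph) (f : R2Fun (G ∘L H)) →
  weight (G ∘L H) f ≡ sumFin (λ (g : Vertex G) → weight H (λ h → f (combine g h)))
weight-∘L G H f = sumFin-combine (n G) {n H} (λ x → labelSize (f x))

adj-∘L : (G H : Graph) (g g′ : Vertex G) (h h′ : Vertex H) →
  adj (G ∘L H) (combine g h) (combine g′ h′) ≡ adj G g g′ ∨ (⌊ g ≟ g′ ⌋ ∧ adj H h h′)
adj-∘L G H g g′ h h′ =
  cong₂ (λ (x y : Vertex G × Vertex H) →
           adj G (proj₁ x) (proj₁ y) ∨ (⌊ proj₁ x ≟ proj₁ y ⌋ ∧ adj H (proj₂ x) (proj₂ y)))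
        (remQuot-combine g h) (remQuot-combine g′ h′)

Adj-∘L⁺ : (G H : Graph) {g g′ : Vertex G} (h h′ : Vertex H) →
  Adj G g g′ → Adj (G ∘L H) (combine g h) (combine g′ h′)
Adj-∘L⁺ G H {g} {g′} h h′ g~g′ =
  trans (adj-∘L G H g g′ h h′) (cong (_∨ (⌊ g ≟ g′ ⌋ ∧ adj H h h′)) g~g′)

Adj-∘L⁻ : (G H : Graph) {g g′ : Vertex G} {h h′ : Vertex H} →
  Adj (G ∘L H) (combine g h) (combine g′ h′) → Adj G g g′ ⊎ (g ≡ g′ × Adj H h h′)
Adj-∘L⁻ G H {g} {g′} {h} {h′} gh~g′h′ =
  cases (g ≟ g′) (trans (sym (adj-∘L G H g g′ h h′)) gh~g′h′)
  where
  cases : (g≟g′ : Dec (g ≡ g′)) → adj G g g′ ∨ (⌊ g≟g′ ⌋ ∧ adj H h h′) ≡ true →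
    Adj G g g′ ⊎ (g ≡ g′ × Adj H h h′)
  cases (yes g≡g′) e = map₂ (g≡g′ ,_) (∨-true (adj G g g′) e)
  cases (no  _)    e = inj₁ (trans (sym (∨-identityʳ (adj G g g′))) e)

halve : ∀ b w → 4 + b2n b ≤ w + w → 2 + b2n b ≤ w
halve false (suc (suc w)) _ = s≤s (s≤s z≤n)
halve true  (suc (suc (suc w))) _ = s≤s (s≤s (s≤s z≤n))
halve false 0 ()
halve false 1 (s≤s (s≤s ()))
halve true  0 ()
halve true  1 (s≤s (s≤s ()))
halve true  2 (s≤s (s≤s (s≤s (s≤s ()))))

two-colour-count≤ : ∀ (a b d₁ d₂ : Bool) w →
  b2n a + b2n b ≤ w →
  (d₁ ≡ false → 2 + b2n b ≤ w) →
  (d₂ ≡ false → 2 + b2n a ≤ w) →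
  (d₁ ≡ false → d₂ ≡ false → 4 ≤ w) →
  (b2n a + b2n (not d₁)) + (b2n b + b2n (not d₂)) ≤ w
two-colour-count≤ a b true true w ab≤w _ _ _ =
  subst (_≤ w) (cong₂ _+_ (sym (+-identityʳ (b2n a))) (sym (+-identityʳ (b2n b)))) ab≤w
two-colour-count≤ false false false true  w _ w₁ _ _ = <⇒≤ (w₁ refl)
two-colour-count≤ false true  false true  w _ w₁ _ _ = <⇒≤ (w₁ refl)
two-colour-count≤ true  false false true  w _ w₁ _ _ = w₁ refl
two-colour-count≤ true  true  false true  w _ w₁ _ _ = w₁ refl
two-colour-count≤ false false true  false w _ _ w₂ _ = <⇒≤ (w₂ refl)
two-colour-count≤ false true  true  false w _ _ w₂ _ = w₂ refl
two-colour-count≤ true  false true  false w _ _ w₂ _ = <⇒≤ (w₂ refl)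
two-colour-count≤ true  true  true  false w _ _ w₂ _ = w₂ refl
two-colour-count≤ false false false false w _ _ _ w₁₂ = <⇒≤ (<⇒≤ (w₁₂ refl refl))
two-colour-count≤ false true  false false w _ _ _ w₁₂ = <⇒≤ (w₁₂ refl refl)
two-colour-count≤ true  false false false w _ _ _ w₁₂ = <⇒≤ (w₁₂ refl refl)
two-colour-count≤ true  true  false false w _ _ _ w₁₂ = w₁₂ refl refl

module LowerBound (G H : Graph) (γr2H≥4 : ∀ f → IsR2DF H f → 4 ≤ weight H f)
                  (f : R2Fun (G ∘L H)) (f-r2df : IsR2DF (G ∘L H) f) where

  fibre : Vertex G → R2Fun H
  fibre g h = f (combine g h)

  carries : Colour → Vertex G → Bool
  carries c g = any (λ h → has c (fibre g h))

  demand : Colour → Vertex G → ℕ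
  demand c g = b2n (carries c g) + b2n (undominated G (carries c) g)

  fibre-neighbour : ∀ c g → dominated G (carries c) g ≡ false →
    ∀ h → fibre g h ≡ ∅ → ∃[ h′ ] (Adj H h h′ × has c (fibre g h′) ≡ true)
  fibre-neighbour c g g-undom h gh≡∅ =
    let y , gh~y , cy = IsR2DF-neighbour (G ∘L H) f f-r2df c (combine g h) gh≡∅
    in combine-elim Goal within-fibre y gh~y cy
    where
    Goal : Vertex (G ∘L H) → Set
    Goal y = Adj (G ∘L H) (combine g h) y → has c (f y) ≡ true →
             ∃[ h′ ] (Adj H h h′ × has c (fibre g h′) ≡ true)
    within-fibre : ∀ g′ h′ → Goal (combine g′ h′)
    within-fibre g′ h′ gh~g′h′ cg′h′ with Adj-∘L⁻ G H gh~g′h′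
    ... | inj₁ g~g′ = contradiction (trans (sym g-undom) g-dom) λ ()
      where
      g-dom : dominated G (carries c) g ≡ true
      g-dom = any-intro (λ u → adj G g u ∧ carries c u) g′
                (cong₂ _∧_ g~g′ (any-intro (λ h″ → has c (fibre g′ h″)) h′ cg′h′))
    ... | inj₂ (refl , h~h′) = h′ , h~h′ , cg′h′

  undominated-fibre-weight : ∀ c g → dominated G (carries c) g ≡ false →
    2 + b2n (carries (other c) g) ≤ weight H (fibre g)
  undominated-fibre-weight c g g-undom = halve (carries (other c) g) (weight H (fibre g))
    (≤-trans (+-monoˡ-≤ (b2n (carries (other c) g))
                (γr2H≥4 _ (saturate-IsR2DF H (fibre g) c (fibre-neighbour c g g-undom))))
             (weight-saturate H (fibre g) c))

  fibre-IsR2DF : ∀ g → dominated G (carries one) g ≡ false → dominated G (carries two) g ≡ false →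
    IsR2DF H (fibre g)
  fibre-IsR2DF g undom₁ undom₂ h gh≡∅ =
    fibre-neighbour one g undom₁ h gh≡∅ , fibre-neighbour two g undom₂ h gh≡∅

  demand≤fibre-weight : ∀ g → demand one g + demand two g ≤ weight H (fibre g)
  demand≤fibre-weight g =
    two-colour-count≤ (carries one g) (carries two g)
      (dominated G (carries one) g) (dominated G (carries two) g) (weight H (fibre g))
      (b2n-any-has≤weight H (fibre g))
      (undominated-fibre-weight one g) (undominated-fibre-weight two g)
      (λ undom₁ undom₂ → γr2H≥4 (fibre g) (fibre-IsR2DF g undom₁ undom₂))

  twice-γt≤weight : (nb : Vertex G → Vertex G) → (∀ v → Adj G v (nb v)) →
    (k : ℕ) → (∀ S → IsTDS G S → k ≤ size G S) → k + k ≤ weight (G ∘L H) f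
  twice-γt≤weight nb v~nb k γt≤ = begin
    k + k
      ≤⟨ +-mono-≤ (γt≤ _ (tdsCompletion-IsTDS G nb v~nb (carries one)))
                  (γt≤ _ (tdsCompletion-IsTDS G nb v~nb (carries two))) ⟩
    card (tdsCompletion G nb (carries one)) + card (tdsCompletion G nb (carries two))
      ≤⟨ +-mono-≤ (card-tdsCompletion G nb (carries one)) (card-tdsCompletion G nb (carries two)) ⟩
    sumFin (demand one) + sumFin (demand two)
      ≡⟨ sumFin-distrib-+ (demand one) (demand two) ⟨
    sumFin (λ g → demand one g + demand two g)
      ≤⟨ sumFin-mono demand≤fibre-weight ⟩
    sumFin (λ g → weight H (fibre g))
      ≡⟨ weight-∘L G H f ⟨
    weight (G ∘L H) f ∎
    where open ≤-Reasoning

module UpperBound (G H : Graph) (S : Vertex G → Bool) (h₀ : Vertex H) where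

  marked : Vertex G → Vertex H → Bool
  marked g h = S g ∧ ⌊ h₀ ≟ h ⌋

  label : Vertex G × Vertex H → Bool × Bool
  label (g , h) = marked g h , marked g h

  lift : R2Fun (G ∘L H)
  lift x = label (remQuot {n G} (n H) x)

  lift-combine : ∀ g h → lift (combine g h) ≡ label (g , h)
  lift-combine g h = cong label (remQuot-combine g h)

  lift-IsR2DF : IsTDS G S → IsR2DF (G ∘L H) lift
  lift-IsR2DF S-tds x _ = neighbour x , neighbour x
    where
    Goal : Vertex (G ∘L H) → Set
    Goal x = ∃[ y ] (Adj (G ∘L H) x y × proj₁ (lift y) ≡ true)
    neighbour : ∀ x → Goal x
    neighbour = combine-elim Goal λ g h →
      let u , g~u , Su = S-tds g
      in combine u h₀ , Adj-∘L⁺ G H h h₀ g~u ,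
         trans (cong proj₁ (lift-combine u h₀)) (cong₂ _∧_ Su (isYes-≟-refl h₀))

  weight-lift : weight (G ∘L H) lift ≡ size G S + size G S
  weight-lift = begin
    weight (G ∘L H) lift
      ≡⟨ weight-∘L G H lift ⟩
    sumFin (λ (g : Vertex G) → weight H (λ h → lift (combine g h)))
      ≡⟨ sumFin-cong (λ g → sumFin-cong (λ h → cong labelSize (lift-combine g h))) ⟩
    sumFin (λ g → sumFin (λ h → b2n (marked g h) + b2n (marked g h)))
      ≡⟨ sumFin-cong (λ g → sumFin-distrib-+ (λ h → b2n (marked g h)) (λ h → b2n (marked g h))) ⟩
    sumFin (λ g → card (marked g) + card (marked g))
      ≡⟨ sumFin-cong (λ g → cong₂ _+_ (card-∧-singleton (S g) h₀) (card-∧-singleton (S g) h₀)) ⟩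
    sumFin (λ g → b2n (S g) + b2n (S g))
      ≡⟨ sumFin-distrib-+ (λ g → b2n (S g)) (λ g → b2n (S g)) ⟩
    size G S + size G S ∎
    where open ≡-Reasoning

theorem11 : (G H : Graph) → Simple G → Simple H →
    NonTrivial G → NonTrivial H → Connected G → Connected H →
    (∀ f → IsR2DF H f → 4 ≤ weight H f) →
    (k : ℕ) → IsγT G k → Isγr2 (G ∘L H) (2 * k)
theorem11 G H _ _ _ H-nontrivial _ _ γr2H≥4 k ((S , S-tds , |S|≡k) , γt≤) = upper , lower
  where
  2k≡k+k : 2 * k ≡ k + k
  2k≡k+k = cong (k +_) (+-identityʳ k)

  open UpperBound G H S (fromℕ< (<⇒≤ H-nontrivial))

  upper : ∃[ f ] (IsR2DF (G ∘L H) f × weight (G ∘L H) f ≡ 2 * k)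
  upper = lift , lift-IsR2DF S-tds , trans weight-lift (trans (cong₂ _+_ |S|≡k |S|≡k) (sym 2k≡k+k))

  lower : ∀ f → IsR2DF (G ∘L H) f → 2 * k ≤ weight (G ∘L H) f
  lower f f-r2df = subst (_≤ weight (G ∘L H) f) (sym 2k≡k+k)
    (LowerBound.twice-γt≤weight G H γr2H≥4 f f-r2df
      (λ v → proj₁ (S-tds v)) (λ v → proj₁ (proj₂ (S-tds v))) k γt≤)
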